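{- Let $\Gamma=(V,E)$ be a finite simple graph with $\mathrm{Aut}(\Gamma)=\{\mathrm{Id}\}$ and $\mathrm{Aut}^{\pi}(\Gamma) \neq \{\mathrm{Id}\}$. Then $\mathrm{Aut}^{\pi}(\Gamma)$ is an abelian group of odd order; for every $\pi \in \mathrm{Aut}^{\pi}(\Gamma)$ and every $v \in V$ one has $\pi(N(v)) = N(\pi^{ -1}(v))$ (i.e. $\gamma(\pi)=\pi^{ -1}$); and the subgraph of $\Gamma$ induced by any orbit of $\mathrm{Aut}^{\pi}(\Gamma)$ on $V$ has no edges.
   Context: For a vertex $v$, $N(v)=\{w : (v,w)\in E\}$. $\mathrm{Aut}^{\pi}(\Gamma)$ is the group of bijections $\pi: V\to V$ such that for every $v\in V$ there exists $w\in V$ with $\pi(N(v)) = N(w)$. For a reduced graph (one in which $N(v)=N(w)$ implies $v=w$) and $\pi\in\mathrm{Aut}^{\pi}(\Gamma)$, $\gamma(\pi)$ denotes the permutation with $N(\gamma(\pi)(v)) = \pi(N(v))$ for all $v$. -}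

module Defs where

open import Data.Nat using (ℕ; _%_)
open import Data.Bool using (Bool; true; false)
open import Data.Fin using (Fin)
open import Data.Fin.Permutation using (Permutation′; _⟨$⟩ʳ_; _⟨$⟩ˡ_)
open import Data.List using (List; length)
open import Data.List.Relation.Unary.All using (All)
open import Data.List.Relation.Unary.Any using (Any)
open import Data.List.Relation.Unary.AllPairs using (AllPairs)
open import Data.Product using (Σ; ∃; _×_)
open import Relation.Nullary using (¬_)
open import Relation.Binary.PropositionalEquality using (_≡_)

record SimpleGraph (n : ℕ) : Set where
  field
    adj   : Fin n → Fin n → Bool
    sym   : ∀ v w → adj v w ≡ adj w v
    irrefl : ∀ v → adj v v ≡ false
open SimpleGraph public

Perm : ℕ → Set
Perm = Permutation′

_≈ₚ_ : ∀ {n} → Perm n → Perm n → Set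
π ≈ₚ σ = ∀ x → π ⟨$⟩ʳ x ≡ σ ⟨$⟩ʳ x

IsId : ∀ {n} → Perm n → Set
IsId π = ∀ x → π ⟨$⟩ʳ x ≡ x

IsAut : ∀ {n} → SimpleGraph n → Perm n → Set
IsAut Γ π = ∀ x y → adj Γ (π ⟨$⟩ʳ x) (π ⟨$⟩ʳ y) ≡ adj Γ x y

-- π(N(v)) = N(w):  x ∈ π(N(v)) iff π⁻¹(x) ∈ N(v)
MapsNbhdTo : ∀ {n} → SimpleGraph n → Perm n → Fin n → Fin n → Set
MapsNbhdTo Γ π v w = ∀ x → adj Γ v (π ⟨$⟩ˡ x) ≡ adj Γ w x

IsAutπ : ∀ {n} → SimpleGraph n → Perm n → Set
IsAutπ Γ π = ∀ v → ∃ λ w → MapsNbhdTo Γ π v w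

AutπOrder : ∀ {n} → SimpleGraph n → ℕ → Set
AutπOrder {n} Γ k =
  Σ (List (Perm n)) λ L →
    AllPairs (λ π σ → ¬ (π ≈ₚ σ)) L
    × All (IsAutπ Γ) L
    × (∀ π → IsAutπ Γ π → Any (π ≈ₚ_) L)
    × length L ≡ k

Odd : ℕ → Set
Odd k = k % 2 ≡ 1

-- Call (γ , π) a two-fold automorphism if (a , b) ∈ E ⇔ (γ a , π b) ∈ E.  Then
-- π ∈ Aut^π(Γ) iff π has such a partner γ, namely γ(π), and Aut(Γ) consists of the π
-- that are their own partner.  If Aut(Γ) is trivial, Γ is reduced and partners are
-- unique.  The map π ↦ γ(π) ∘ π⁻¹ is injective on the finite set Aut^π(Γ), hence onto,
-- and each γ(π) ∘ π⁻¹ has its own inverse as partner; so γ(π) = π⁻¹ for all π.  The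
-- rest follows: uniqueness of partners makes Aut^π(Γ) abelian; inversion is an
-- involution fixing only the identity, so the order is odd; and squaring is injective,
-- so every π is a square σ², which rules out an edge between v and σ² v.

module Submission where

open import Defs renaming (sym to adj-sym)
open import Data.Nat using (ℕ; zero; suc; _*_; _<_)
open import Data.Nat.DivMod using ([m+kn]%n≡m%n)
open import Data.Nat.Induction using (<-wellFounded)
open import Data.Nat.Properties using (1+n≰n; n≤1+n; ≤-trans; ≤-reflexive)
open import Data.Bool using (false) renaming (_≟_ to _≟ᵇ_)
open import Data.Fin using (Fin; zero; suc; punchOut; punchIn)
open import Data.Fin.Properties using (_≟_; any?; all?; injective⇒≤; punchOut-injective)
open import Data.Fin.Permutation
  using (_⟨$⟩ʳ_; _⟨$⟩ˡ_; _∘ₚ_; id; flip; inverseˡ; inverseʳ; permutation; transpose; insert; remove; insert-remove; insert-punchIn)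
open import Data.List using (List; []; _∷_; [_]; length; lookup; map; filter; deduplicate; cartesianProduct; allFin)
open import Data.List.Properties using (filter-accept; filter-reject; filter-all; length-tabulate)
open import Data.List.Relation.Unary.All as All using (All; _∷_)
open import Data.List.Relation.Unary.All.Properties using (all-filter; deduplicate⁺)
open import Data.List.Relation.Unary.Any as Any using (Any; here; there)
open import Data.List.Relation.Unary.Any.Properties using (lookup-index)
open import Data.List.Relation.Unary.AllPairs using (_∷_)
open import Data.List.Relation.Unary.Unique.Propositional using (Unique)
open import Data.List.Relation.Unary.Unique.Propositional.Properties using (filter⁺; allFin⁺)
open import Data.List.Relation.Unary.Unique.DecSetoid.Properties using (deduplicate-!)
import Data.List.Relation.Unary.Unique.Setoid as SetoidUnique
open import Data.List.Relation.Unary.Enumerates.Setoid using (IsEnumeration)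
open import Data.List.Relation.Unary.Enumerates.Setoid.Properties using (map⁺; cartesianProduct⁺)
open import Data.List.Membership.Propositional using (_∈_)
open import Data.List.Membership.Propositional.Properties using (∈-filter⁺; ∈-filter⁻; ∈-allFin; ∈-lookup)
import Data.List.Membership.Setoid as SetoidMembership
import Data.List.Membership.Setoid.Properties as SetoidMembershipₚ
import Relation.Binary.Reasoning.Setoid as SetoidReasoning
open import Data.Product using (Σ; ∃; _×_; _,_; proj₁; proj₂; uncurry)
open import Data.Product.Relation.Binary.Pointwise.NonDependent using (_×ₛ_)
open import Function using (_∘_; Injective)
open import Function.Bundles using (Surjection)
open import Function.Consequences.Setoid using (strictlySurjective⇒surjective)
open import Induction.WellFounded using (Acc; acc)
open import Level using (0ℓ)
open import Relation.Binary.Bundles using (Setoid; DecSetoid)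
open import Relation.Binary.Definitions using (DecidableEquality)
open import Relation.Nullary using (¬_; Dec; yes; no; ¬?; contradiction)
open import Relation.Unary using (Pred; Decidable)
open import Relation.Binary.PropositionalEquality
  using (_≡_; _≢_; _≗_; refl; sym; trans; cong; cong₂; subst; subst₂; ≢-sym; module ≡-Reasoning)
  renaming (setoid to ≡-setoid)

Fin-injective⇒surjective : ∀ {k} {f : Fin k → Fin k} → Injective _≡_ _≡_ f → ∀ y → ∃ λ x → f x ≡ y
Fin-injective⇒surjective {suc _} {f} f-injective y with any? (λ x → f x ≟ y)
... | yes hit = hit
... | no miss = contradiction (injective⇒≤ punchOut-f-injective) 1+n≰n
  where
  y≢f : ∀ x → y ≢ f x
  y≢f x y≡fx = miss (x , sym y≡fx)

  punchOut-f-injective : Injective _≡_ _≡_ (λ x → punchOut (y≢f x))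
  punchOut-f-injective eq = f-injective (punchOut-injective (y≢f _) (y≢f _) eq)

injective⇒permutation : ∀ {k} (f : Fin k → Fin k) → Injective _≡_ _≡_ f → Perm k
injective⇒permutation {k} f f-injective = permutation f f⁻¹ f∘f⁻¹ (λ x → f-injective (f∘f⁻¹ (f x)))
  where
  f⁻¹ : Fin k → Fin k
  f⁻¹ y = proj₁ (Fin-injective⇒surjective f-injective y)

  f∘f⁻¹ : ∀ y → f (f⁻¹ y) ≡ y
  f∘f⁻¹ y = proj₂ (Fin-injective⇒surjective f-injective y)

module _ {A : Set} (_≟ᴬ_ : DecidableEquality A) where

  ≢? : ∀ y → Decidable (_≢ y)
  ≢? y z = ¬? (z ≟ᴬ y)

  delete : A → List A → List A
  delete y = filter (≢? y)

  length-delete : ∀ {y xs} → Unique xs → y ∈ xs → length xs ≡ suc (length (delete y xs))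
  length-delete {xs = x ∷ xs} (x∉xs ∷ _) (here refl) =
    cong (suc ∘ length) (sym (trans (filter-reject (≢? x) (λ x≢x → x≢x refl)) (filter-all (≢? x) (All.map ≢-sym x∉xs))))
  length-delete {y} {x ∷ xs} (x∉xs ∷ xs!) (there y∈xs) =
    trans (cong suc (length-delete xs! y∈xs))
          (cong (suc ∘ length) (sym (filter-accept (≢? y) (All.lookup x∉xs y∈xs))))

  module _ (F : A → A) (F-involutive : ∀ x → F (F x) ≡ x) where

    involution⇒even-length : ∀ {xs} → Unique xs
      → (∀ {x} → x ∈ xs → F x ∈ xs) → (∀ {x} → x ∈ xs → F x ≢ x)
      → ∃ λ m → length xs ≡ m * 2
    involution⇒even-length {xs} = go (<-wellFounded (length xs))
      where
      go : ∀ {xs} → Acc _<_ (length xs) → Unique xs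
        → (∀ {x} → x ∈ xs → F x ∈ xs) → (∀ {x} → x ∈ xs → F x ≢ x)
        → ∃ λ m → length xs ≡ m * 2
      go {[]} _ _ _ _ = 0 , refl
      go {x ∷ ys} (acc rec) (x∉ys ∷ ys!) closed free =
        suc (proj₁ zs-even) , cong suc (trans ys≡1+zs (cong suc (proj₂ zs-even)))
        where
        -- the pair x, F x is dropped
        zs : List A
        zs = delete (F x) ys

        Fx∈ys : F x ∈ ys
        Fx∈ys with closed (here refl)
        ... | here Fx≡x = contradiction Fx≡x (free (here refl))
        ... | there Fx∈ys = Fx∈ys

        ys≡1+zs : length ys ≡ suc (length zs)
        ys≡1+zs = length-delete ys! Fx∈ys

        zs<xs : length zs < length (x ∷ ys)
        zs<xs = ≤-trans (n≤1+n _) (≤-reflexive (cong suc (sym ys≡1+zs)))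

        zs-closed : ∀ {z} → z ∈ zs → F z ∈ zs
        zs-closed {z} z∈zs = ∈-filter⁺ (≢? (F x)) Fz∈ys Fz≢Fx
          where
          z∈ys : z ∈ ys
          z∈ys = proj₁ (∈-filter⁻ (≢? (F x)) {xs = ys} z∈zs)

          z≢Fx : z ≢ F x
          z≢Fx = proj₂ (∈-filter⁻ (≢? (F x)) {xs = ys} z∈zs)

          Fz∈ys : F z ∈ ys
          Fz∈ys with closed (there z∈ys)
          ... | here Fz≡x = contradiction (trans (sym (F-involutive z)) (cong F Fz≡x)) z≢Fx
          ... | there Fz∈ys = Fz∈ys

          Fz≢Fx : F z ≢ F x
          Fz≢Fx Fz≡Fx = All.lookup x∉ys z∈ys
            (trans (sym (F-involutive x)) (trans (cong F (sym Fz≡Fx)) (F-involutive z)))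

        zs-free : ∀ {z} → z ∈ zs → F z ≢ z
        zs-free = free ∘ there ∘ proj₁ ∘ ∈-filter⁻ (≢? (F x))

        zs-even : ∃ λ m → length zs ≡ m * 2
        zs-even = go (rec zs<xs) (filter⁺ (≢? (F x)) ys!) zs-closed zs-free

Fin-involution⇒odd : ∀ {k} (F : Fin k → Fin k) → (∀ x → F (F x) ≡ x)
  → (c : Fin k) → F c ≡ c → (∀ x → F x ≡ x → x ≡ c) → Odd k
Fin-involution⇒odd {k} F F-involutive c Fc≡c fixed≡c =
  subst Odd 1+m*2≡k ([m+kn]%n≡m%n 1 m 2)
  where
  rest : List (Fin k)
  rest = delete _≟_ c (allFin k)

  rest-closed : ∀ {x} → x ∈ rest → F x ∈ rest
  rest-closed {x} x∈rest = ∈-filter⁺ (≢? _≟_ c) (∈-allFin (F x))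
    λ Fx≡c → proj₂ (∈-filter⁻ (≢? _≟_ c) {xs = allFin k} x∈rest) (trans (sym (F-involutive x)) (trans (cong F Fx≡c) Fc≡c))

  rest-free : ∀ {x} → x ∈ rest → F x ≢ x
  rest-free x∈rest Fx≡x = proj₂ (∈-filter⁻ (≢? _≟_ c) {xs = allFin k} x∈rest) (fixed≡c _ Fx≡x)

  rest-even : ∃ λ m → length rest ≡ m * 2
  rest-even = involution⇒even-length _≟_ F F-involutive (filter⁺ (≢? _≟_ c) (allFin⁺ k)) rest-closed rest-free

  m : ℕ
  m = proj₁ rest-even

  1+m*2≡k : suc (m * 2) ≡ k
  1+m*2≡k = begin
    suc (m * 2)             ≡⟨ cong suc (proj₂ rest-even) ⟨
    suc (length rest)       ≡⟨ length-delete _≟_ (allFin⁺ k) (∈-allFin c) ⟨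
    length (allFin k)       ≡⟨ length-tabulate _ ⟩
    k                       ∎
    where open ≡-Reasoning

module EnumeratedSubset {a ℓ p} (S : Setoid a ℓ) {P : Pred (Setoid.Carrier S) p}
  (xs : List (Setoid.Carrier S)) (xs! : SetoidUnique.Unique S xs)
  (sound : All P xs) (complete : ∀ x → P x → SetoidMembership._∈_ S x xs)
  where

  open Setoid S using (_≈_) renaming (Carrier to A; reflexive to ≈-reflexive; sym to ≈-sym; trans to ≈-trans)
  open SetoidReasoning S

  -- Through lookup and Any.index, the subset enumerated by xs is in bijection
  -- with Fin (length xs), where the counting arguments above apply.
  private
    elem : Fin (length xs) → A
    elem = lookup xs

    index : ∀ x → P x → Fin (length xs)
    index x px = Any.index (complete x px)

    ≈-elem-index : ∀ x px → x ≈ elem (index x px)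
    ≈-elem-index x px = lookup-index (complete x px)

    P-elem : ∀ i → P (elem i)
    P-elem i = All.lookup sound (∈-lookup i)

    lookup-injective : ∀ {ys} → SetoidUnique.Unique S ys → ∀ {i j} → lookup ys i ≈ lookup ys j → i ≡ j
    lookup-injective (_ ∷ _)     {zero}  {zero}  _  = refl
    lookup-injective (y≉ys ∷ _)  {zero}  {suc j} y≈ = contradiction y≈ (All.lookup y≉ys (∈-lookup j))
    lookup-injective (y≉ys ∷ _)  {suc i} {zero}  ≈y = contradiction (≈-sym ≈y) (All.lookup y≉ys (∈-lookup i))
    lookup-injective (_ ∷ ys!)   {suc i} {suc j} eq = cong suc (lookup-injective ys! eq)

    elem-injective : ∀ {i j} → elem i ≈ elem j → i ≡ j
    elem-injective = lookup-injective xs!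

  injective⇒surjective : (f : ∀ x → P x → A) → (∀ x px → P (f x px))
    → (∀ x y px py → f x px ≈ f y py → x ≈ y)
    → ∀ y → P y → ∃ λ x → Σ (P x) λ px → f x px ≈ y
  injective⇒surjective f P-f f-injective y py = elem i , P-elem i , fi≈y
    where
    f′ : ∀ i → A
    f′ i = f (elem i) (P-elem i)

    g : Fin (length xs) → Fin (length xs)
    g i = index (f′ i) (P-f _ (P-elem i))

    f′≈elem-g : ∀ i → f′ i ≈ elem (g i)
    f′≈elem-g i = ≈-elem-index _ (P-f _ (P-elem i))

    g-injective : Injective _≡_ _≡_ g
    g-injective {i} {j} gi≡gj = elem-injective (f-injective _ _ (P-elem i) (P-elem j) (begin
      f′ i         ≈⟨ f′≈elem-g i ⟩
      elem (g i)   ≡⟨ cong elem gi≡gj ⟩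
      elem (g j)   ≈⟨ f′≈elem-g j ⟨
      f′ j         ∎))

    i : Fin (length xs)
    i = proj₁ (Fin-injective⇒surjective g-injective (index y py))

    fi≈y : f′ i ≈ y
    fi≈y = begin
      f′ i                 ≈⟨ f′≈elem-g i ⟩
      elem (g i)           ≡⟨ cong elem (proj₂ (Fin-injective⇒surjective g-injective (index y py))) ⟩
      elem (index y py)    ≈⟨ ≈-elem-index y py ⟨
      y                    ∎

  involution⇒odd-length : (F : A → A) → (∀ x → P x → P (F x)) → (∀ x y → x ≈ y → F x ≈ F y)
    → (∀ x → F (F x) ≈ x) → ∀ c → P c → F c ≈ c → (∀ x → P x → F x ≈ x → x ≈ c)
    → Odd (length xs)
  involution⇒odd-length F P-F F-cong F-involutive c pc Fc≈c fixed≈c =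
    Fin-involution⇒odd G G-involutive (index c pc) G-fixes-c G-fixed≡c
    where
    G : Fin (length xs) → Fin (length xs)
    G i = index (F (elem i)) (P-F _ (P-elem i))

    F-elem≈elem-G : ∀ i → F (elem i) ≈ elem (G i)
    F-elem≈elem-G i = ≈-elem-index _ (P-F _ (P-elem i))

    G-involutive : ∀ i → G (G i) ≡ i
    G-involutive i = elem-injective (begin
      elem (G (G i))       ≈⟨ F-elem≈elem-G (G i) ⟨
      F (elem (G i))       ≈⟨ F-cong _ _ (F-elem≈elem-G i) ⟨
      F (F (elem i))       ≈⟨ F-involutive (elem i) ⟩
      elem i               ∎)

    G-fixes-c : G (index c pc) ≡ index c pc
    G-fixes-c = elem-injective (begin
      elem (G (index c pc))   ≈⟨ F-elem≈elem-G (index c pc) ⟨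
      F (elem (index c pc))   ≈⟨ F-cong _ _ (≈-elem-index c pc) ⟨
      F c                     ≈⟨ Fc≈c ⟩
      c                       ≈⟨ ≈-elem-index c pc ⟩
      elem (index c pc)       ∎)

    G-fixed≡c : ∀ i → G i ≡ i → i ≡ index c pc
    G-fixed≡c i Gi≡i = elem-injective (begin
      elem i               ≈⟨ fixed≈c (elem i) (P-elem i) (≈-trans (F-elem≈elem-G i) (≈-reflexive (cong elem Gi≡i))) ⟩
      c                    ≈⟨ ≈-elem-index c pc ⟩
      elem (index c pc)    ∎)

_≈ₚ?_ : ∀ {n} (π σ : Perm n) → Dec (π ≈ₚ σ)
π ≈ₚ? σ = all? λ x → π ⟨$⟩ʳ x ≟ σ ⟨$⟩ʳ x

Perm-decSetoid : ℕ → DecSetoid 0ℓ 0ℓ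
Perm-decSetoid n = record
  { Carrier = Perm n
  ; _≈_ = _≈ₚ_
  ; isDecEquivalence = record
    { isEquivalence = record
      { refl = λ _ → refl
      ; sym = λ π≈σ x → sym (π≈σ x)
      ; trans = λ π≈σ σ≈τ x → trans (π≈σ x) (σ≈τ x)
      }
    ; _≟_ = _≈ₚ?_
    }
  }

Perm-setoid : ℕ → Setoid 0ℓ 0ℓ
Perm-setoid n = DecSetoid.setoid (Perm-decSetoid n)

flip-cong : ∀ {n} (π σ : Perm n) → π ≈ₚ σ → flip π ≈ₚ flip σ
flip-cong π σ π≈σ x = begin
  π ⟨$⟩ˡ x                       ≡⟨ inverseˡ σ ⟨
  σ ⟨$⟩ˡ (σ ⟨$⟩ʳ (π ⟨$⟩ˡ x))     ≡⟨ cong (σ ⟨$⟩ˡ_) (π≈σ _) ⟨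
  σ ⟨$⟩ˡ (π ⟨$⟩ʳ (π ⟨$⟩ˡ x))     ≡⟨ cong (σ ⟨$⟩ˡ_) (inverseʳ π) ⟩
  σ ⟨$⟩ˡ x                       ∎
  where open ≡-Reasoning

insert₀-cong : ∀ {n} j {σ τ : Perm n} → σ ≈ₚ τ → insert zero j σ ≈ₚ insert zero j τ
insert₀-cong j σ≈τ zero = refl
insert₀-cong j {σ} {τ} σ≈τ (suc x) = begin
  insert zero j σ ⟨$⟩ʳ suc x   ≡⟨ insert-punchIn zero j σ x ⟩
  punchIn j (σ ⟨$⟩ʳ x)         ≡⟨ cong (punchIn j) (σ≈τ x) ⟩
  punchIn j (τ ⟨$⟩ʳ x)         ≡⟨ insert-punchIn zero j τ x ⟨
  insert zero j τ ⟨$⟩ʳ suc x   ∎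
  where open ≡-Reasoning

perms : ∀ n → List (Perm n)
perms zero = [ id ]
perms (suc n) = map (uncurry (insert zero)) (cartesianProduct (allFin (suc n)) (perms n))

insert₀-surjection : ∀ n → Surjection (≡-setoid (Fin (suc n)) ×ₛ Perm-setoid n) (Perm-setoid (suc n))
insert₀-surjection n = record
  { to = uncurry (insert zero)
  ; cong = cong′
  ; surjective = strictlySurjective⇒surjective (≡-setoid (Fin (suc n)) ×ₛ Perm-setoid n) (Perm-setoid (suc n))
      {f = uncurry (insert zero)} cong′
      λ π → (π ⟨$⟩ʳ zero , remove zero π) , insert-remove zero π
  }
  where
  cong′ : ∀ {(i , σ) (j , τ) : Fin (suc n) × Perm n} → i ≡ j × σ ≈ₚ τ → insert zero i σ ≈ₚ insert zero j τ
  cong′ (refl , σ≈τ) = insert₀-cong _ σ≈τ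

perms-enumerates : ∀ n → IsEnumeration (Perm-setoid n) (perms n)
perms-enumerates zero π = here λ ()
perms-enumerates (suc n) = map⁺ _ _ (insert₀-surjection n)
  (cartesianProduct⁺ (≡-setoid _) (Perm-setoid n) ∈-allFin (perms-enumerates n))

-- Two-fold automorphisms

module _ {n} (Γ : SimpleGraph n) where

  IsTFAut : (Fin n → Fin n) → (Fin n → Fin n) → Set
  IsTFAut γ π = ∀ a b → adj Γ (γ a) (π b) ≡ adj Γ a b

  TF-sym : ∀ {γ π} → IsTFAut γ π → IsTFAut π γ
  TF-sym tf a b = trans (adj-sym Γ _ _) (trans (tf b a) (adj-sym Γ b a))

  TF-∘ : ∀ {γ π γ′ π′} → IsTFAut γ π → IsTFAut γ′ π′ → IsTFAut (γ ∘ γ′) (π ∘ π′)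
  TF-∘ tf tf′ a b = trans (tf _ _) (tf′ a b)

  TF-cong : ∀ {γ π γ′ π′} → γ ≗ γ′ → π ≗ π′ → IsTFAut γ π → IsTFAut γ′ π′
  TF-cong γ≗γ′ π≗π′ tf a b = subst₂ (λ s t → adj Γ s t ≡ adj Γ a b) (γ≗γ′ a) (π≗π′ b) (tf a b)

  TF-flip : ∀ (γ π : Perm n) → IsTFAut (γ ⟨$⟩ʳ_) (π ⟨$⟩ʳ_) → IsTFAut (γ ⟨$⟩ˡ_) (π ⟨$⟩ˡ_)
  TF-flip γ π tf a b = trans (sym (tf _ _)) (cong₂ (adj Γ) (inverseʳ γ) (inverseʳ π))

  TF⇒MapsNbhdTo : ∀ {γ} π → IsTFAut γ (π ⟨$⟩ʳ_) → ∀ v → MapsNbhdTo Γ π v (γ v)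
  TF⇒MapsNbhdTo {γ} π tf v x = trans (sym (tf v (π ⟨$⟩ˡ x))) (cong (adj Γ (γ v)) (inverseʳ π))

  TF⇒Autπ : ∀ {γ} π → IsTFAut γ (π ⟨$⟩ʳ_) → IsAutπ Γ π
  TF⇒Autπ {γ} π tf v = γ v , TF⇒MapsNbhdTo π tf v

  partner : ∀ π → IsAutπ Γ π → Fin n → Fin n
  partner π h v = proj₁ (h v)

  Autπ⇒TF : ∀ π (h : IsAutπ Γ π) → IsTFAut (partner π h) (π ⟨$⟩ʳ_)
  Autπ⇒TF π h a b = trans (sym (proj₂ (h a) (π ⟨$⟩ʳ b))) (cong (adj Γ a) (inverseˡ π))

  IsAutπ-resp : ∀ {π σ : Perm n} → π ≈ₚ σ → IsAutπ Γ π → IsAutπ Γ σ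
  IsAutπ-resp {π} {σ} π≈σ h = TF⇒Autπ σ (TF-cong (λ _ → refl) π≈σ (Autπ⇒TF π h))

  IsAutπ? : ∀ π → Dec (IsAutπ Γ π)
  IsAutπ? π = all? λ v → any? λ w → all? λ x → adj Γ v (π ⟨$⟩ˡ x) ≟ᵇ adj Γ w x

  IsReduced : Set
  IsReduced = ∀ v w → (∀ x → adj Γ v x ≡ adj Γ w x) → v ≡ w

  -- Transposing two vertices with equal neighbourhoods is an automorphism.
  rigid⇒reduced : (∀ π → IsAut Γ π → IsId π) → IsReduced
  rigid⇒reduced rigid v w twins = trans (sym (rigid τ τ-aut v)) τv≡w
    where
    τ : Perm n
    τ = transpose v w

    τv≡w : τ ⟨$⟩ʳ v ≡ w
    τv≡w with v ≟ v
    ... | yes _ = refl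
    ... | no v≢v = contradiction refl v≢v

    τ-twin : ∀ x z → adj Γ (τ ⟨$⟩ʳ x) z ≡ adj Γ x z
    τ-twin x z with x ≟ v
    ... | yes refl = sym (twins z)
    ... | no _ with x ≟ w
    ...   | yes refl = twins z
    ...   | no _ = refl

    τ-aut : IsAut Γ τ
    τ-aut x y = trans (τ-twin x _) (trans (adj-sym Γ x _) (trans (τ-twin y x) (adj-sym Γ y x)))

  module _ (reduced : IsReduced) where

    TF-unique : ∀ π {γ γ′} → IsTFAut γ (π ⟨$⟩ʳ_) → IsTFAut γ′ (π ⟨$⟩ʳ_) → γ ≗ γ′
    TF-unique π {γ} {γ′} tf tf′ a = reduced (γ a) (γ′ a) λ x → begin
      adj Γ (γ a) x                      ≡⟨ cong (adj Γ (γ a)) (inverseʳ π) ⟨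
      adj Γ (γ a) (π ⟨$⟩ʳ (π ⟨$⟩ˡ x))    ≡⟨ tf a (π ⟨$⟩ˡ x) ⟩
      adj Γ a (π ⟨$⟩ˡ x)                 ≡⟨ tf′ a (π ⟨$⟩ˡ x) ⟨
      adj Γ (γ′ a) (π ⟨$⟩ʳ (π ⟨$⟩ˡ x))   ≡⟨ cong (adj Γ (γ′ a)) (inverseʳ π) ⟩
      adj Γ (γ′ a) x                     ∎
      where open ≡-Reasoning

    TF-partner-injective : ∀ {γ π} → IsTFAut γ π → Injective _≡_ _≡_ γ
    TF-partner-injective {γ} {π} tf {a} {a′} γa≡γa′ = reduced a a′ λ x → begin
      adj Γ a x               ≡⟨ tf a x ⟨
      adj Γ (γ a) (π x)       ≡⟨ cong (λ t → adj Γ t (π x)) γa≡γa′ ⟩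
      adj Γ (γ a′) (π x)      ≡⟨ tf a′ x ⟩
      adj Γ a′ x              ∎
      where open ≡-Reasoning

    partner-permutation : ∀ π → IsAutπ Γ π → Perm n
    partner-permutation π h = injective⇒permutation (partner π h) (TF-partner-injective (Autπ⇒TF π h))

module Rigid {n} (Γ : SimpleGraph n) (rigid : ∀ π → IsAut Γ π → IsId π) where

  private
    reduced : IsReduced Γ
    reduced = rigid⇒reduced Γ rigid

    γ : ∀ π → IsAutπ Γ π → Perm n
    γ = partner-permutation Γ reduced

  autπs : List (Perm n)
  autπs = deduplicate _≈ₚ?_ (filter (IsAutπ? Γ) (perms n))

  autπs-distinct : SetoidUnique.Unique (Perm-setoid n) autπs
  autπs-distinct = deduplicate-! (Perm-decSetoid n) _

  autπs-sound : All (IsAutπ Γ) autπs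
  autπs-sound = deduplicate⁺ _≈ₚ?_ (all-filter (IsAutπ? Γ) (perms n))

  autπs-complete : ∀ π → IsAutπ Γ π → Any (π ≈ₚ_) autπs
  autπs-complete π h =
    SetoidMembershipₚ.∈-deduplicate⁺ (Perm-setoid n) _≈ₚ?_
      (λ σ≈τ π≈σ x → trans (π≈σ x) (sym (σ≈τ x))) {xs = filter (IsAutπ? Γ) (perms n)} {z = π}
      (SetoidMembershipₚ.∈-filter⁺ (Perm-setoid n) (IsAutπ? Γ) (λ {σ} {τ} → IsAutπ-resp Γ {σ} {τ})
        {v = π} {xs = perms n} (perms-enumerates n π) h)

  open EnumeratedSubset (Perm-setoid n) autπs autπs-distinct autπs-sound autπs-complete

  -- φ π = γ(π) ∘ π⁻¹, as _∘ₚ_ composes diagrammatically.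
  φ : ∀ π → IsAutπ Γ π → Perm n
  φ π h = flip π ∘ₚ γ π h

  φ-TF : ∀ π (h : IsAutπ Γ π) → IsTFAut Γ (φ π h ⟨$⟩ˡ_) (φ π h ⟨$⟩ʳ_)
  φ-TF π h = TF-∘ Γ {π ⟨$⟩ʳ_} {γ π h ⟨$⟩ʳ_}
    (TF-sym Γ (Autπ⇒TF Γ π h)) (TF-flip Γ (γ π h) π (Autπ⇒TF Γ π h))

  φ-Autπ : ∀ π (h : IsAutπ Γ π) → IsAutπ Γ (φ π h)
  φ-Autπ π h = TF⇒Autπ Γ (φ π h) (φ-TF π h)

  φ-injective : ∀ π σ (hπ : IsAutπ Γ π) (hσ : IsAutπ Γ σ) → φ π hπ ≈ₚ φ σ hσ → π ≈ₚ σ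
  φ-injective π σ hπ hσ φπ≈φσ a = begin
    π ⟨$⟩ʳ a                          ≡⟨ inverseʳ σ ⟨
    σ ⟨$⟩ʳ (σ ⟨$⟩ˡ (π ⟨$⟩ʳ a))        ≡⟨ cong (σ ⟨$⟩ʳ_) (rigid (π ∘ₚ flip σ) σ⁻¹π-aut a) ⟩
    σ ⟨$⟩ʳ a                          ∎
    where
    open ≡-Reasoning
    γπ γσ : Perm n
    γπ = γ π hπ
    γσ = γ σ hσ

    γσ⁻¹γπ≗σ⁻¹π : ∀ a → γσ ⟨$⟩ˡ (γπ ⟨$⟩ʳ a) ≡ σ ⟨$⟩ˡ (π ⟨$⟩ʳ a)
    γσ⁻¹γπ≗σ⁻¹π a = begin
      γσ ⟨$⟩ˡ (γπ ⟨$⟩ʳ a)                       ≡⟨ cong (λ t → γσ ⟨$⟩ˡ (γπ ⟨$⟩ʳ t)) (inverseˡ π) ⟨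
      γσ ⟨$⟩ˡ (γπ ⟨$⟩ʳ (π ⟨$⟩ˡ (π ⟨$⟩ʳ a)))     ≡⟨ cong (γσ ⟨$⟩ˡ_) (φπ≈φσ (π ⟨$⟩ʳ a)) ⟩
      γσ ⟨$⟩ˡ (γσ ⟨$⟩ʳ (σ ⟨$⟩ˡ (π ⟨$⟩ʳ a)))     ≡⟨ inverseˡ γσ ⟩
      σ ⟨$⟩ˡ (π ⟨$⟩ʳ a)                         ∎

    σ⁻¹π-aut : IsAut Γ (π ∘ₚ flip σ)
    σ⁻¹π-aut = TF-cong Γ γσ⁻¹γπ≗σ⁻¹π (λ _ → refl)
      (TF-∘ Γ (TF-flip Γ γσ σ (Autπ⇒TF Γ σ hσ)) (Autπ⇒TF Γ π hπ))

  -- γ(π) = π⁻¹, as φ is onto Aut^π(Γ).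
  Autπ⇒TF-inverse : ∀ π → IsAutπ Γ π → IsTFAut Γ (π ⟨$⟩ˡ_) (π ⟨$⟩ʳ_)
  Autπ⇒TF-inverse π h =
    let ρ , hρ , φρ≈π = injective⇒surjective φ φ-Autπ φ-injective π h
    in TF-cong Γ (flip-cong (φ ρ hρ) π φρ≈π) φρ≈π (φ-TF ρ hρ)

  Autπ-flip : ∀ π → IsAutπ Γ π → IsAutπ Γ (flip π)
  Autπ-flip π h = TF⇒Autπ Γ (flip π) (TF-sym Γ (Autπ⇒TF-inverse π h))

  Autπ-∘ : ∀ π σ → IsAutπ Γ π → IsAutπ Γ σ → IsAutπ Γ (π ∘ₚ σ)
  Autπ-∘ π σ hπ hσ = TF⇒Autπ Γ (π ∘ₚ σ) (TF-∘ Γ (Autπ⇒TF-inverse σ hσ) (Autπ⇒TF-inverse π hπ))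

  -- π ∘ σ and σ ∘ π both have partner π⁻¹ ∘ σ⁻¹, and partners determine each other.
  Autπ-commute : ∀ π σ → IsAutπ Γ π → IsAutπ Γ σ → ∀ x → π ⟨$⟩ʳ (σ ⟨$⟩ʳ x) ≡ σ ⟨$⟩ʳ (π ⟨$⟩ʳ x)
  Autπ-commute π σ hπ hσ = TF-unique Γ reduced (flip (π ∘ₚ σ))
    (TF-∘ Γ (TF-sym Γ (Autπ⇒TF-inverse π hπ)) (TF-sym Γ (Autπ⇒TF-inverse σ hσ)))
    (TF-sym Γ (Autπ⇒TF-inverse (π ∘ₚ σ) (Autπ-∘ π σ hπ hσ)))

  maps-nbhd-to-inverse : ∀ π → IsAutπ Γ π → ∀ v → MapsNbhdTo Γ π v (π ⟨$⟩ˡ v)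
  maps-nbhd-to-inverse π h = TF⇒MapsNbhdTo Γ π (Autπ⇒TF-inverse π h)

  flip-fixed⇒id : ∀ π → IsAutπ Γ π → flip π ≈ₚ π → π ≈ₚ id
  flip-fixed⇒id π h π⁻¹≈π = rigid π (TF-cong Γ π⁻¹≈π (λ _ → refl) (Autπ⇒TF-inverse π h))

  Autπ-odd : Odd (length autπs)
  Autπ-odd = involution⇒odd-length flip Autπ-flip flip-cong (λ _ _ → refl)
    id (TF⇒Autπ Γ id (λ _ _ → refl)) (λ _ → refl) flip-fixed⇒id

  square : Perm n → Perm n
  square σ = σ ∘ₚ σ

  Autπ-square : ∀ σ → IsAutπ Γ σ → IsAutπ Γ (square σ)
  Autπ-square σ h = Autπ-∘ σ σ h h

  -- If σ² = τ² then σ⁻¹ ∘ τ = σ ∘ τ⁻¹, so (σ⁻¹ ∘ τ , σ⁻¹ ∘ τ) is a two-fold automorphism.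
  square-injective : ∀ σ τ → IsAutπ Γ σ → IsAutπ Γ τ → square σ ≈ₚ square τ → σ ≈ₚ τ
  square-injective σ τ hσ hτ σ²≈τ² a = begin
    σ ⟨$⟩ʳ a                       ≡⟨ cong (σ ⟨$⟩ʳ_) (rigid (τ ∘ₚ flip σ) σ⁻¹τ-aut a) ⟨
    σ ⟨$⟩ʳ (σ ⟨$⟩ˡ (τ ⟨$⟩ʳ a))     ≡⟨ inverseʳ σ ⟩
    τ ⟨$⟩ʳ a                       ∎
    where
    open ≡-Reasoning
    στ⁻¹≗σ⁻¹τ : ∀ a → σ ⟨$⟩ʳ (τ ⟨$⟩ˡ a) ≡ σ ⟨$⟩ˡ (τ ⟨$⟩ʳ a)
    στ⁻¹≗σ⁻¹τ a = begin
      σ ⟨$⟩ʳ (τ ⟨$⟩ˡ a)                             ≡⟨ inverseˡ σ ⟨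
      σ ⟨$⟩ˡ (σ ⟨$⟩ʳ (σ ⟨$⟩ʳ (τ ⟨$⟩ˡ a)))           ≡⟨ cong (σ ⟨$⟩ˡ_) (σ²≈τ² (τ ⟨$⟩ˡ a)) ⟩
      σ ⟨$⟩ˡ (τ ⟨$⟩ʳ (τ ⟨$⟩ʳ (τ ⟨$⟩ˡ a)))           ≡⟨ cong (λ t → σ ⟨$⟩ˡ (τ ⟨$⟩ʳ t)) (inverseʳ τ) ⟩
      σ ⟨$⟩ˡ (τ ⟨$⟩ʳ a)                             ∎

    σ⁻¹τ-aut : IsAut Γ (τ ∘ₚ flip σ)
    σ⁻¹τ-aut = TF-cong Γ (λ _ → refl) στ⁻¹≗σ⁻¹τ
      (TF-∘ Γ (Autπ⇒TF-inverse σ hσ) (TF-sym Γ (Autπ⇒TF-inverse τ hτ)))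

  -- (v , σ² v) is the image of the non-edge (σ v , σ v) under the two-fold automorphism (σ⁻¹ , σ).
  no-edge-to-square : ∀ σ → IsAutπ Γ σ → ∀ v → adj Γ v (square σ ⟨$⟩ʳ v) ≡ false
  no-edge-to-square σ h v = begin
    adj Γ v (σ ⟨$⟩ʳ (σ ⟨$⟩ʳ v))                  ≡⟨ cong (λ t → adj Γ t (σ ⟨$⟩ʳ (σ ⟨$⟩ʳ v))) (inverseˡ σ) ⟨
    adj Γ (σ ⟨$⟩ˡ (σ ⟨$⟩ʳ v)) (σ ⟨$⟩ʳ (σ ⟨$⟩ʳ v)) ≡⟨ Autπ⇒TF-inverse σ h (σ ⟨$⟩ʳ v) (σ ⟨$⟩ʳ v) ⟩
    adj Γ (σ ⟨$⟩ʳ v) (σ ⟨$⟩ʳ v)                  ≡⟨ irrefl Γ _ ⟩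
    false                                        ∎
    where open ≡-Reasoning

  no-edge-in-orbit : ∀ π → IsAutπ Γ π → ∀ v → adj Γ v (π ⟨$⟩ʳ v) ≡ false
  no-edge-in-orbit π h v =
    let σ , hσ , σ²≈π = injective⇒surjective (λ σ _ → square σ) Autπ-square square-injective π h
    in subst (λ t → adj Γ v t ≡ false) (σ²≈π v) (no-edge-to-square σ hσ v)

theorem6p2 : ∀ {n} (Γ : SimpleGraph n)
    → (∀ π → IsAut Γ π → IsId π)
    → (∃ λ π → IsAutπ Γ π × ¬ IsId π)
    → (∀ π σ → IsAutπ Γ π → IsAutπ Γ σ → ∀ x → π ⟨$⟩ʳ (σ ⟨$⟩ʳ x) ≡ σ ⟨$⟩ʳ (π ⟨$⟩ʳ x))
      × (∃ λ k → AutπOrder Γ k × Odd k)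
      × (∀ π → IsAutπ Γ π → ∀ v → MapsNbhdTo Γ π v (π ⟨$⟩ˡ v))
      × (∀ π → IsAutπ Γ π → ∀ v → adj Γ v (π ⟨$⟩ʳ v) ≡ false)
theorem6p2 Γ rigid _ =
    Autπ-commute
  , (length autπs , (autπs , autπs-distinct , autπs-sound , autπs-complete , refl) , Autπ-odd)
  , maps-nbhd-to-inverse
  , no-edge-in-orbit
  where open Rigid Γ rigid
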